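{- The minimum integer $n$ such that for every $2$-coloring of $[1,n] \times [1,n]$ there exist $a,b,x,d \in \mathbb{Z}^+$ with $(a,x)$, $(b,x+d)$, and $(a+b,x+2d)$ all in $[1,n]\times[1,n]$ and all of the same color, is $n=9$.
   Context: $[1,n]=\{1,2,\dots,n\}$. -}

module Defs where

open import Data.Nat using (ℕ; _+_; _*_; _≤_)
open import Data.Bool using (Bool)
open import Data.Product using (Σ; ∃-syntax; _×_)
open import Relation.Binary.PropositionalEquality using (_≡_)

InRange : ℕ → ℕ → Set
InRange n k = 1 ≤ k × k ≤ n

-- a 2-coloring of [1,n] × [1,n]: only its values on [1,n]² are used
Coloring : Set
Coloring = ℕ → ℕ → Bool

MonoConfig : ℕ → Coloring → ℕ → ℕ → ℕ → ℕ → Set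
MonoConfig n c a b x d =
  1 ≤ a × 1 ≤ b × 1 ≤ x × 1 ≤ d ×
  InRange n a × InRange n x ×
  InRange n b × InRange n (x + d) ×
  InRange n (a + b) × InRange n (x + 2 * d) ×
  c b (x + d) ≡ c a x × c (a + b) (x + 2 * d) ≡ c a x

Property : ℕ → Set
Property n = (c : Coloring) → ∃[ a ] ∃[ b ] ∃[ x ] ∃[ d ] MonoConfig n c a b x d

IsMinimum : (ℕ → Set) → ℕ → Set
IsMinimum P n = P n × ((m : ℕ) → P m → n ≤ m)

{-# OPTIONS --safe #-}
-- Upper bound: an exhaustive case analysis on the colours of 26 cells of [1,9]², recorded as a
-- decision tree (found by computer search) whose every branch forces a monochromatic
-- configuration; the tree is checked by evaluation.
-- Lower bound: a colouring c a x = f x that depends only on the second coordinate turns a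
-- configuration into a monochromatic progression x, x + d, x + 2d of f, and the colouring
-- f = 01011010 of [1,8] has no monochromatic 3-term progression (van der Waerden W(3,2) = 9).
module Submission where

open import Defs
open import Data.Bool using (Bool; true; false; if_then_else_)
open import Data.Bool.Properties using () renaming (_≟_ to _≟ᵇ_)
open import Data.List using (List; []; _∷_)
open import Data.List.Relation.Unary.All using (All; []; _∷_)
open import Data.Maybe using (Maybe; just; nothing)
import Data.Maybe.Properties as Maybe
open import Data.Nat using (ℕ; _+_; _*_; _≤_; _<_; _≤?_; s≤s)
open import Data.Nat.Properties
  using (_≟_; ≤-trans; ≰⇒>; m≤m+n; m≤n+m; anyUpTo?)
open import Data.Product using (∃-syntax; _×_; _,_)
import Data.Product.Properties as Product
open import Data.Empty using (⊥-elim)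
open import Data.Sum using (inj₁; inj₂)
open import Relation.Nullary using (Dec; does; yes; no; ¬_; _×-dec_; _⊎-dec_)
open import Relation.Nullary.Decidable using (map′; toWitness; toWitnessFalse)
open import Relation.Binary.Definitions using (DecidableEquality)
open import Relation.Binary.PropositionalEquality using (_≡_; refl; trans; sym)

Cell : Set
Cell = ℕ × ℕ

_≟ᶜ_ : DecidableEquality Cell
_≟ᶜ_ = Product.≡-dec _≟_ _≟_

Assignment : Set
Assignment = List (Cell × Bool)

colourAt : Assignment → Cell → Maybe Bool
colourAt []             p = nothing
colourAt ((q , v) ∷ σ) p = if does (q ≟ᶜ p) then just v else colourAt σ p

Agrees : Coloring → Assignment → Set
Agrees c = All λ { ((i , j) , v) → c i j ≡ v }

colourAt-sound : ∀ {c σ i j v} → Agrees c σ → colourAt σ (i , j) ≡ just v → c i j ≡ v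
colourAt-sound {σ = ((k , l) , _) ∷ _} {i} {j} (ckl≡v ∷ agrees) eq
  with (k , l) ≟ᶜ (i , j)
... | yes refl = trans ckl≡v (Maybe.just-injective eq)
... | no _     = colourAt-sound agrees eq

KnownMonochromatic : Assignment → Cell → Cell → Cell → Set
KnownMonochromatic σ p q r =
  ∃[ v ] colourAt σ p ≡ just v × colourAt σ q ≡ just v × colourAt σ r ≡ just v

knownMonochromatic? : ∀ σ p q r → Dec (KnownMonochromatic σ p q r)
knownMonochromatic? σ p q r =
  map′ (λ { (inj₁ h) → true , h ; (inj₂ h) → false , h })
       (λ { (true , h) → inj₁ h ; (false , h) → inj₂ h })
       (monochromaticIn true ⊎-dec monochromaticIn false)
  where
  _≟ᵐ_ : DecidableEquality (Maybe Bool)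
  _≟ᵐ_ = Maybe.≡-dec _≟ᵇ_
  monochromaticIn : ∀ v →
    Dec (colourAt σ p ≡ just v × colourAt σ q ≡ just v × colourAt σ r ≡ just v)
  monochromaticIn v =
    (colourAt σ p ≟ᵐ just v) ×-dec (colourAt σ q ≟ᵐ just v) ×-dec (colourAt σ r ≟ᵐ just v)

inRange? : ∀ n k → Dec (InRange n k)
inRange? n k = (1 ≤? k) ×-dec (k ≤? n)

Admissible : ℕ → ℕ → ℕ → ℕ → ℕ → Set
Admissible n a b x d =
  1 ≤ a × 1 ≤ b × 1 ≤ x × 1 ≤ d ×
  InRange n a × InRange n x ×
  InRange n b × InRange n (x + d) ×
  InRange n (a + b) × InRange n (x + 2 * d)

admissible? : ∀ n a b x d → Dec (Admissible n a b x d)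
admissible? n a b x d =
  (1 ≤? a) ×-dec (1 ≤? b) ×-dec (1 ≤? x) ×-dec (1 ≤? d) ×-dec
  inRange? n a ×-dec inRange? n x ×-dec
  inRange? n b ×-dec inRange? n (x + d) ×-dec
  inRange? n (a + b) ×-dec inRange? n (x + 2 * d)

mkMonoConfig : ∀ {n c a b x d} → Admissible n a b x d →
               c b (x + d) ≡ c a x → c (a + b) (x + 2 * d) ≡ c a x →
               MonoConfig n c a b x d
mkMonoConfig (p₁ , p₂ , p₃ , p₄ , p₅ , p₆ , p₇ , p₈ , p₉ , p₁₀) e₁ e₂ =
  p₁ , p₂ , p₃ , p₄ , p₅ , p₆ , p₇ , p₈ , p₉ , p₁₀ , e₁ , e₂

data Certificate : Set where
  leaf : (a b x d : ℕ) → Certificate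
  node : (i j : ℕ) → Certificate → Certificate → Certificate

Certifies : ℕ → Assignment → Certificate → Set
Certifies n σ (leaf a b x d) =
  Admissible n a b x d × KnownMonochromatic σ (a , x) (b , x + d) (a + b , x + 2 * d)
Certifies n σ (node i j t f) =
  Certifies n (((i , j) , true) ∷ σ) t × Certifies n (((i , j) , false) ∷ σ) f

certifies? : ∀ n σ t → Dec (Certifies n σ t)
certifies? n σ (leaf a b x d) =
  admissible? n a b x d ×-dec knownMonochromatic? σ (a , x) (b , x + d) (a + b , x + 2 * d)
certifies? n σ (node i j t f) =
  certifies? n (((i , j) , true) ∷ σ) t ×-dec certifies? n (((i , j) , false) ∷ σ) f

certifies⇒monoConfig : ∀ {n c} σ t → Agrees c σ → Certifies n σ t →
                       ∃[ a ] ∃[ b ] ∃[ x ] ∃[ d ] MonoConfig n c a b x d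
certifies⇒monoConfig {c = c} σ (leaf a b x d) agrees
                     (admissible , v , ax≡v , by≡v , cz≡v) =
  a , b , x , d , mkMonoConfig {c = c} admissible (sameAs-ax by≡v) (sameAs-ax cz≡v)
  where
  sameAs-ax : ∀ {i j} → colourAt σ (i , j) ≡ just v → c i j ≡ c a x
  sameAs-ax eq = trans (colourAt-sound agrees eq) (sym (colourAt-sound agrees ax≡v))
certifies⇒monoConfig {c = c} σ (node i j t f) agrees (certT , certF) with c i j in cij
... | true  = certifies⇒monoConfig _ t (cij ∷ agrees) certT
... | false = certifies⇒monoConfig _ f (cij ∷ agrees) certF


certificate₉ : Certificate
certificate₉ =
  (node 1 5 (node 2 5 (node 1 3 (node 1 1 (leaf 1 1 1 2) (node 1 4 (leaf 1 1 3 1) (node 2 7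
  (leaf 1 1 3 2) (leaf 1 1 1 3)))) (node 1 4 (node 2 6 (leaf 1 1 4 1) (node 3 9 (node 1 1
  (leaf 1 2 1 4) (node 3 6 (leaf 1 2 4 1) (node 2 7 (leaf 1 2 5 2) (node 4 9 (node 3 7
  (leaf 1 3 5 2) (node 2 4 (node 2 1 (leaf 2 1 1 4) (node 3 5 (node 4 6 (leaf 1 3 4 1)
  (node 5 9 (node 4 7 (leaf 1 4 5 2) (node 3 4 (node 2 3 (leaf 2 1 3 1) (node 1 2 (node 2 8
  (leaf 1 1 2 3) (node 3 8 (leaf 1 2 2 3) (node 1 6 (node 4 8 (leaf 1 3 2 3) (leaf 2 2 6 1))
  (leaf 1 2 6 1)))) (leaf 1 1 1 1))) (leaf 1 3 1 3))) (leaf 1 4 3 3))) (leaf 2 1 1 2)))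
  (leaf 1 2 1 3))) (leaf 1 3 3 3))))) (leaf 1 2 3 3))) (node 3 5 (node 2 3 (node 1 1
  (leaf 1 2 1 2) (node 2 7 (node 1 6 (leaf 1 1 5 1) (node 2 9 (node 2 8 (node 1 2
  (leaf 1 1 2 3) (node 2 4 (node 2 6 (node 1 7 (leaf 1 1 5 2) (node 3 7 (leaf 1 2 5 1)
  (node 3 9 (leaf 1 2 5 2) (node 4 8 (leaf 2 2 4 2) (leaf 1 3 6 1))))) (leaf 1 1 2 2))
  (leaf 1 1 2 1))) (leaf 1 1 4 2)) (leaf 1 1 3 3))) (leaf 1 1 1 3))) (node 2 4 (node 3 6
  (leaf 2 1 4 1) (node 4 9 (node 1 1 (leaf 1 3 1 4) (node 1 2 (node 2 7 (leaf 2 2 5 2)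
  (leaf 1 1 1 3)) (leaf 1 1 1 1))) (leaf 1 3 3 3))) (node 1 2 (node 2 8 (leaf 1 1 2 3)
  (node 1 6 (node 2 7 (leaf 1 1 5 1) (node 1 1 (node 2 9 (leaf 1 1 1 4) (node 3 9
  (leaf 1 2 1 4) (node 3 8 (leaf 1 2 2 3) (node 2 6 (node 3 7 (leaf 1 2 5 1) (node 1 7
  (node 4 9 (leaf 1 3 1 4) (leaf 2 2 7 1)) (leaf 1 2 7 1))) (leaf 1 2 3 3)))))
  (leaf 1 1 1 3))) (leaf 1 1 4 2))) (leaf 1 1 2 1)))) (node 2 4 (node 4 7 (node 4 6
  (leaf 2 2 4 1) (leaf 1 3 4 1)) (leaf 1 3 3 2)) (leaf 1 2 3 1))))) (node 1 3 (node 2 7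
  (leaf 1 1 3 2) (node 4 9 (node 3 6 (leaf 1 3 3 3) (node 1 4 (node 2 6 (leaf 1 1 4 1)
  (node 3 7 (leaf 1 3 5 2) (node 1 6 (node 2 9 (leaf 1 1 3 3) (node 2 8 (leaf 1 1 4 2)
  (node 4 7 (node 3 5 (leaf 1 3 3 2) (node 5 9 (leaf 1 4 5 2) (leaf 2 3 5 2)))
  (leaf 2 2 5 1)))) (leaf 2 1 5 1)))) (leaf 1 2 4 1))) (leaf 2 2 5 2))) (node 1 1 (node 2 9
  (leaf 1 1 1 4) (node 1 4 (node 2 7 (leaf 1 1 1 3) (node 1 6 (node 2 6 (leaf 1 1 4 1)
  (node 2 8 (leaf 1 1 4 2) (node 3 7 (node 2 4 (leaf 1 2 1 3) (node 1 2 (node 2 3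
  (leaf 1 1 1 1) (node 3 5 (node 3 9 (node 4 9 (leaf 1 3 1 4) (leaf 2 2 3 3)) (leaf 1 2 3 3))
  (leaf 1 2 3 1))) (leaf 1 1 2 1))) (leaf 1 2 3 2)))) (leaf 1 1 3 3))) (leaf 1 1 3 1)))
  (leaf 1 1 1 2)))) (node 2 5 (node 1 3 (node 1 1 (leaf 1 1 1 2) (node 2 9 (node 1 4
  (leaf 1 1 3 1) (node 2 7 (node 1 6 (leaf 1 1 3 3) (node 2 6 (node 2 8 (node 3 7
  (leaf 1 2 3 2) (node 2 4 (node 1 2 (leaf 1 1 2 1) (node 2 3 (node 3 5 (leaf 1 2 3 1)
  (node 3 9 (leaf 1 2 3 3) (node 4 9 (leaf 2 2 3 3) (leaf 1 3 1 4)))) (leaf 1 1 1 1)))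
  (leaf 1 2 1 3))) (leaf 1 1 4 2)) (leaf 1 1 4 1))) (leaf 1 1 1 3))) (leaf 1 1 1 4)))
  (node 2 7 (node 4 9 (leaf 2 2 5 2) (node 3 6 (node 1 4 (leaf 1 2 4 1) (node 2 6 (node 3 7
  (node 1 6 (leaf 2 1 5 1) (node 2 9 (node 2 8 (node 4 7 (leaf 2 2 5 1) (node 3 5 (node 5 9
  (leaf 2 3 5 2) (leaf 1 4 5 2)) (leaf 1 3 3 2))) (leaf 1 1 4 2)) (leaf 1 1 3 3)))
  (leaf 1 3 5 2)) (leaf 1 1 4 1))) (leaf 1 3 3 3))) (leaf 1 1 3 2))) (node 1 3 (node 1 4
  (node 3 5 (node 2 4 (leaf 1 2 3 1) (node 4 7 (leaf 1 3 3 2) (node 4 6 (leaf 1 3 4 1)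
  (leaf 2 2 4 1)))) (node 2 3 (node 2 4 (node 1 2 (leaf 1 1 2 1) (node 2 8 (node 1 6
  (leaf 1 1 4 2) (node 2 7 (node 1 1 (leaf 1 1 1 3) (node 2 9 (node 3 9 (node 3 8 (node 2 6
  (leaf 1 2 3 3) (node 3 7 (node 1 7 (leaf 1 2 7 1) (node 4 9 (leaf 2 2 7 1) (leaf 1 3 1 4)))
  (leaf 1 2 5 1))) (leaf 1 2 2 3)) (leaf 1 2 1 4)) (leaf 1 1 1 4))) (leaf 1 1 5 1)))
  (leaf 1 1 2 3))) (node 3 6 (node 4 9 (leaf 1 3 3 3) (node 1 1 (node 1 2 (leaf 1 1 1 1)
  (node 2 7 (leaf 1 1 1 3) (leaf 2 2 5 2))) (leaf 1 3 1 4))) (leaf 2 1 4 1))) (node 1 1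
  (node 2 7 (leaf 1 1 1 3) (node 1 6 (node 2 9 (leaf 1 1 3 3) (node 2 8 (leaf 1 1 4 2)
  (node 1 2 (node 2 4 (leaf 1 1 2 1) (node 2 6 (leaf 1 1 2 2) (node 1 7 (node 3 7 (node 3 9
  (node 4 8 (leaf 1 3 6 1) (leaf 2 2 4 2)) (leaf 1 2 5 2)) (leaf 1 2 5 1)) (leaf 1 1 5 2))))
  (leaf 1 1 2 3)))) (leaf 1 1 5 1))) (leaf 1 2 1 2)))) (node 2 6 (node 3 9 (leaf 1 2 3 3)
  (node 1 1 (node 3 6 (node 2 7 (node 4 9 (leaf 1 3 3 3) (node 3 7 (node 2 4 (leaf 1 2 1 3)
  (node 2 1 (node 3 5 (leaf 2 1 1 2) (node 4 6 (node 5 9 (leaf 1 4 3 3) (node 4 7 (node 3 4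
  (leaf 1 3 1 3) (node 2 3 (node 1 2 (leaf 1 1 1 1) (node 2 8 (node 3 8 (node 1 6
  (leaf 1 2 6 1) (node 4 8 (leaf 2 2 6 1) (leaf 1 3 2 3))) (leaf 1 2 2 3)) (leaf 1 1 2 3)))
  (leaf 2 1 3 1))) (leaf 1 4 5 2))) (leaf 1 3 4 1))) (leaf 2 1 1 4))) (leaf 1 3 5 2)))
  (leaf 1 2 5 2)) (leaf 1 2 4 1)) (leaf 1 2 1 4))) (leaf 1 1 4 1))) (node 1 1 (node 1 4
  (node 2 7 (leaf 1 1 1 3) (leaf 1 1 3 2)) (leaf 1 1 3 1)) (leaf 1 1 1 2)))))

property₉ : Property 9
property₉ c =
  certifies⇒monoConfig [] certificate₉ [] (toWitness {a? = certifies? 9 [] certificate₉} _)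

MonochromaticAP : ℕ → (ℕ → Bool) → ℕ → ℕ → Set
MonochromaticAP n f x d =
  1 ≤ x × 1 ≤ d × x + 2 * d ≤ n × f (x + d) ≡ f x × f (x + 2 * d) ≡ f x

monochromaticAP? : ∀ n f x d → Dec (MonochromaticAP n f x d)
monochromaticAP? n f x d =
  (1 ≤? x) ×-dec (1 ≤? d) ×-dec (x + 2 * d ≤? n) ×-dec
  (f (x + d) ≟ᵇ f x) ×-dec (f (x + 2 * d) ≟ᵇ f x)

property⇒monochromaticAP : ∀ {n} → Property n → (f : ℕ → Bool) →
                           ∃[ x ] ∃[ d ] MonochromaticAP n f x d
property⇒monochromaticAP property f
  with property (λ _ x → f x)
... | _ , _ , x , d , _ , _ , 1≤x , 1≤d , _ , _ , _ , _ , _ , (_ , x+2d≤n) , e₁ , e₂ =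
  x , d , 1≤x , 1≤d , x+2d≤n , e₁ , e₂

stripes : ℕ → Bool
stripes 2 = true
stripes 4 = true
stripes 5 = true
stripes 7 = true
stripes _ = false

stripes-noMonochromaticAP₈ : ∀ x d → ¬ MonochromaticAP 8 stripes x d
stripes-noMonochromaticAP₈ x d ap@(_ , _ , x+2d≤8 , _) =
  toWitnessFalse {a? = search} _ (x , s≤s x≤8 , d , s≤s d≤8 , ap)
  where
  search : Dec (∃[ x ] x < 9 × ∃[ d ] d < 9 × MonochromaticAP 8 stripes x d)
  search = anyUpTo? (λ x → anyUpTo? (monochromaticAP? 8 stripes x) 9) 9
  x≤8 : x ≤ 8
  x≤8 = ≤-trans (m≤m+n x (2 * d)) x+2d≤8
  d≤8 : d ≤ 8
  d≤8 = ≤-trans (≤-trans (m≤m+n d (d + 0)) (m≤n+m (2 * d) x)) x+2d≤8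

property⇒9≤ : ∀ m → Property m → 9 ≤ m
property⇒9≤ m property with 9 ≤? m
... | yes 9≤m = 9≤m
... | no 9≰m with ≰⇒> 9≰m | property⇒monochromaticAP property stripes
...   | s≤s m≤8 | x , d , 1≤x , 1≤d , x+2d≤m , e₁ , e₂ =
  ⊥-elim (stripes-noMonochromaticAP₈ x d (1≤x , 1≤d , ≤-trans x+2d≤m m≤8 , e₁ , e₂))

theorem21 : IsMinimum Property 9
theorem21 = property₉ , property⇒9≤
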